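{- Let $G$ be a graph that is both a modular graph and a partial cube, with at least three vertices and with $\Theta$-classes $E_1,\ldots,E_d$. Then \begin{align*} SWW_3(G) &= \frac{3|V(G)|-6}{8}\sum_{i=1}^d n_i^0n_i^1+\frac{|V(G)|-2}{4}\sum_{i=1}^{d-1}\sum_{j=i+1}^d\left(n_{ij}^{00}n_{ij}^{11}+n_{ij}^{01}n_{ij}^{10}\right)\\ &\quad+\frac18\sum_{i=1}^d\left(n_i^0n_i^1(n_i^1-1)+n_i^1n_i^0(n_i^0-1)\right)\\ &\quad+\frac14\sum_{i=1}^{d-1}\sum_{j=i+1}^d\Big(3n_{ij}^{00}n_{ij}^{01}n_{ij}^{10}+3n_{ij}^{00}n_{ij}^{01}n_{ij}^{11}+3n_{ij}^{00}n_{ij}^{10}n_{ij}^{11}+3n_{ij}^{01}n_{ij}^{10}n_{ij}^{11}\\ &\qquad+n_{ij}^{00}n_{ij}^{11}(n_{ij}^{11}-1)+n_{ij}^{01}n_{ij}^{10}(n_{ij}^{10}-1)+n_{ij}^{10}n_{ij}^{01}(n_{ij}^{01}-1)+n_{ij}^{11}n_{ij}^{00}(n_{ij}^{00}-1)\Big). \end{align*}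
   Context: Graphs are finite, simple, connected; $d(u,v)$ is the shortest-path distance. A median of vertices $u,v,w$ is a vertex lying on a shortest $u,v$-path, a shortest $u,w$-path and a shortest $v,w$-path; $G$ is modular if every triple of vertices has at least one median. For nonempty $S\subseteq V(G)$, the Steiner distance $d(S)$ is the minimum number of edges of a connected subgraph whose vertex set contains $S$, and $SWW_3(G)=\frac12\sum_{S\subseteq V(G),|S|=3}d(S)+\frac12\sum_{S\subseteq V(G),|S|=3}d(S)^2$. A partial cube is a graph isomorphic to an isometric subgraph of a hypercube. Two edges $u_1v_1$, $u_2v_2$ are in relation $\Theta$ if $d(u_1,u_2)+d(v_1,v_2)\ne d(u_1,v_2)+d(v_1,u_2)$; in a partial cube $\Theta$ is an equivalence relation whose classes are the $\Theta$-classes, and for each $\Theta$-class $E_i$ the graph $G-E_i$ has exactly two connected components, denoted $U_i$ and $U_i'$. Set $n_i^0=|V(U_i)|$, $n_i^1=|V(U_i')|$, and for $i\ne j$: $n_{ij}^{00}=|V(U_i)\cap V(U_j)|$, $n_{ij}^{01}=|V(U_i)\cap V(U_j')|$, $n_{ij}^{10}=|V(U_i')\cap V(U_j)|$, $n_{ij}^{11}=|V(U_i')\cap V(U_j')|$. -}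

module Defs where

open import Data.Nat using (ℕ; zero; suc; _+_; _*_; _∸_; _≤_; _<_; _<ᵇ_)
open import Data.Bool using (Bool; true; false; T; if_then_else_; _∧_; not)
open import Data.Fin using (Fin; toℕ)
open import Data.Fin.Properties using (_≟_)
open import Data.Product using (Σ; ∃; _×_; _,_; proj₁; proj₂)
open import Data.Sum using (_⊎_)
open import Data.List using (List; length)
open import Data.List.Membership.Propositional using (_∈_)
open import Data.List.Relation.Unary.All using (All)
open import Data.List.Relation.Unary.Unique.Propositional using (Unique)
open import Relation.Binary.PropositionalEquality using (_≡_; _≢_)
open import Relation.Nullary using (¬_; does)

sumFin : ∀ {m} → (Fin m → ℕ) → ℕ
sumFin {zero}  f = 0
sumFin {suc m} f = f Fin.zero + sumFin (λ i → f (Fin.suc i))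

ind : Bool → ℕ
ind true  = 1
ind false = 0

record Graph (n : ℕ) : Set where
  field
    adj     : Fin n → Fin n → Bool
    adj-sym : ∀ u v → adj u v ≡ adj v u
    irrefl  : ∀ u → adj u u ≡ false

open Graph public

Adj : ∀ {n} → Graph n → Fin n → Fin n → Set
Adj G u v = T (adj G u v)

data Walk {n : ℕ} (E : Fin n → Fin n → Set) : Fin n → Fin n → ℕ → Set where
  here : ∀ {u} → Walk E u u 0
  step : ∀ {u w v k} → E u w → Walk E w v k → Walk E u v (suc k)

Connected : ∀ {n} → Graph n → Set
Connected G = ∀ u v → ∃ λ k → Walk (Adj G) u v k

IsDistance : ∀ {n} → Graph n → (Fin n → Fin n → ℕ) → Set
IsDistance G d = ∀ u v → Walk (Adj G) u v (d u v)
                       × (∀ k → Walk (Adj G) u v k → d u v ≤ k)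

OnGeodesic : ∀ {n} → (Fin n → Fin n → ℕ) → Fin n → Fin n → Fin n → Set
OnGeodesic d u v m = d u m + d m v ≡ d u v

Modular : ∀ {n} → (Fin n → Fin n → ℕ) → Set
Modular {n} d = ∀ u v w → ∃ λ (m : Fin n) →
  OnGeodesic d u v m × OnGeodesic d u w m × OnGeodesic d v w m

hamming : ∀ {k} → (Fin k → Bool) → (Fin k → Bool) → ℕ
hamming x y = sumFin (λ i → ind (not (does (Data.Bool._≟_ (x i) (y i)))))
  where import Data.Bool

PartialCube : ∀ {n} → Graph n → (Fin n → Fin n → ℕ) → Set
PartialCube {n} G d = ∃ λ k → ∃ λ (f : Fin n → (Fin k → Bool)) →
    (∀ u v → f u ≡ f v → u ≡ v)
  × (∀ u v → (Adj G u v → hamming (f u) (f v) ≡ 1)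
           × (hamming (f u) (f v) ≡ 1 → Adj G u v))
  × (∀ u v → d u v ≡ hamming (f u) (f v))

Θ : ∀ {n} → (Fin n → Fin n → ℕ) → Fin n → Fin n → Fin n → Fin n → Set
Θ d u₁ v₁ u₂ v₂ = d u₁ u₂ + d v₁ v₂ ≢ d u₁ v₂ + d v₁ u₂

-- cls enumerates the Θ-classes as E_1, ..., E_d (indexed by Fin D):
-- cls u v is the index of the class of the edge uv (junk on non-edges)
ThetaClasses : ∀ {n} → Graph n → (Fin n → Fin n → ℕ) →
               (D : ℕ) → (Fin n → Fin n → Fin D) → Set
ThetaClasses {n} G d D cls =
    (∀ u v → Adj G u v → cls u v ≡ cls v u)
  × (∀ u₁ v₁ u₂ v₂ → Adj G u₁ v₁ → Adj G u₂ v₂ →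
        (cls u₁ v₁ ≡ cls u₂ v₂ → Θ d u₁ v₁ u₂ v₂)
      × (Θ d u₁ v₁ u₂ v₂ → cls u₁ v₁ ≡ cls u₂ v₂))
  × (∀ i → ∃ λ u → ∃ λ v → Adj G u v × cls u v ≡ i)

AdjMinus : ∀ {n D} → Graph n → (Fin n → Fin n → Fin D) → Fin D →
           Fin n → Fin n → Set
AdjMinus G cls i u v = Adj G u v × cls u v ≢ i

-- side i : V → Bool splits V into the two components of G - E_i:
-- side i u ≡ false means u ∈ U_i, side i u ≡ true means u ∈ U_i'
Sides : ∀ {n D} → Graph n → (Fin n → Fin n → Fin D) →
        (Fin D → Fin n → Bool) → Set
Sides {n} {D} G cls side = ∀ (i : Fin D) (u v : Fin n) →
    (side i u ≡ side i v → ∃ λ k → Walk (AdjMinus G cls i) u v k)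
  × ((∃ λ k → Walk (AdjMinus G cls i) u v k) → side i u ≡ side i v)

EdgeIn : ∀ {n} → List (Fin n × Fin n) → Fin n → Fin n → Set
EdgeIn Es x y = ((x , y) ∈ Es) ⊎ ((y , x) ∈ Es)

-- (Vs, Es) is a connected subgraph of G; each edge {a,b} is listed once,
-- as (a , b) with a < b
ConnectedSubgraph : ∀ {n} → Graph n → (Fin n → Bool) →
                    List (Fin n × Fin n) → Set
ConnectedSubgraph G Vs Es =
    All (λ e → (toℕ (proj₁ e) < toℕ (proj₂ e)) × Adj G (proj₁ e) (proj₂ e)
               × T (Vs (proj₁ e)) × T (Vs (proj₂ e))) Es
  × Unique Es
  × (∀ x y → T (Vs x) → T (Vs y) → ∃ λ k → Walk (EdgeIn Es) x y k)

IsSteiner3 : ∀ {n} → Graph n → Fin n → Fin n → Fin n → ℕ → Set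
IsSteiner3 G u v w k =
    (∃ λ Vs → ∃ λ Es → ConnectedSubgraph G Vs Es
        × T (Vs u) × T (Vs v) × T (Vs w) × length Es ≡ k)
  × (∀ Vs Es → ConnectedSubgraph G Vs Es
        → T (Vs u) → T (Vs v) → T (Vs w) → k ≤ length Es)

lt : ∀ {m} → Fin m → Fin m → Bool
lt a b = toℕ a <ᵇ toℕ b

sumTriples : ∀ {n} → (Fin n → Fin n → Fin n → ℕ) → ℕ
sumTriples f = sumFin λ u → sumFin λ v → sumFin λ w →
  if lt u v ∧ lt v w then f u v w else 0

sumPairs : ∀ {m} → (Fin m → Fin m → ℕ) → ℕ
sumPairs f = sumFin λ i → sumFin λ j → if lt i j then f i j else 0

-- 2 · SWW_3(G) = Σ_{|S|=3} (d(S) + d(S)^2), for sd a Steiner-distance function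
twoSWW3 : ∀ {n} → (Fin n → Fin n → Fin n → ℕ) → ℕ
twoSWW3 sd = sumTriples λ u v w → sd u v w + sd u v w * sd u v w

cnt1 : ∀ {n D} → (Fin D → Fin n → Bool) → Fin D → Bool → ℕ
cnt1 side i a = sumFin λ u → ind (does (Data.Bool._≟_ (side i u) a))
  where import Data.Bool

cnt2 : ∀ {n D} → (Fin D → Fin n → Bool) → Fin D → Fin D → Bool → Bool → ℕ
cnt2 side i j a b = sumFin λ u →
  ind (does (Data.Bool._≟_ (side i u) a) ∧ does (Data.Bool._≟_ (side j u) b))
  where import Data.Bool

-- In a partial cube every Θ-class E_i is a cut, and d(u,v) is the number of
-- classes whose two sides separate u and v.  For a triple S = {u,v,w} every
-- connected subgraph containing S has an edge in each class separating S,
-- while the union of geodesics from u, v, w to a median has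
-- (d(u,v) + d(u,w) + d(v,w))/2 edges, which is again that number.  So
-- d(S) = Σ_i x_i(S) with x_i(S) ∈ {0,1} recording whether E_i separates S, and
-- d(S) + d(S)² = 2 Σ_i x_i + 2 Σ_{i<j} x_i x_j.  Summed over all triples,
-- inclusion–exclusion gives Σ_S x_i = C(n,3) − C(n_i^0,3) − C(n_i^1,3) and
-- Σ_S x_i x_j = C(n,3) − Σ C(n_i^·,3) − Σ C(n_j^·,3) + Σ C(n_ij^··,3), and
-- Vandermonde's identity turns these into the stated polynomials.

module Submission where

open import Defs
open import Data.Bool as Bool using (Bool; true; false; T; if_then_else_; _∧_; _∨_; not)
open import Data.Empty using (⊥-elim)
open import Data.Fin as Fin using (Fin; toℕ)
import Data.Fin.Properties as Finₚ
open import Data.List using (List; []; _∷_; length; map; _++_; deduplicate)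
open import Data.List.Properties using (length-map; length-++; length-deduplicate)
open import Data.List.Membership.Propositional using (_∈_)
open import Data.List.Membership.Propositional.Properties
  using (∈-map⁺; ∈-++⁺ˡ; ∈-++⁺ʳ; ∈-++⁻; ∈-deduplicate⁺; ∈-deduplicate⁻)
import Data.List.Membership.DecPropositional as DecMembership
open import Data.List.Relation.Unary.All as All using ()
open import Data.List.Relation.Unary.Any using (here; there)
open import Data.List.Relation.Unary.Unique.DecPropositional.Properties using (deduplicate-!)
open import Data.Nat using (ℕ; zero; suc; _+_; _*_; _∸_; _≤_; _<_; z≤n; s≤s; _<?_)
open import Data.Nat.Combinatorics using (_C_; nC1≡n; nCk+nC[k+1]≡[n+1]C[k+1])
open import Data.Nat.Properties
open import Algebra.Properties.CommutativeSemigroup +-commutativeSemigroup using (interchange)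
open import Data.Nat.Tactic.RingSolver using (solve-∀)
open import Data.Product as Product using (∃; _×_; _,_; proj₁; proj₂)
open import Data.Product.Properties using (≡-dec)
open import Data.Sum as Sum using (_⊎_; inj₁; inj₂; [_,_]′)
open import Function using (_∘_)
open import Relation.Binary.PropositionalEquality
open import Relation.Nullary using (¬_; Dec; yes; no; does)
open import Relation.Nullary.Decidable using (isYes; toWitness; fromWitness)

-- With this equality test the counts cnt1, cnt2 and hamming of Defs are
-- literally sums of ind (_ == _).
infix 7 _==_
_==_ : Bool → Bool → Bool
a == b = does (a Bool.≟ b)

split₃ : Bool → Bool → Bool → Bool
split₃ a b c = not (a == b ∧ b == c)

ind-∧ : ∀ p q → ind (p ∧ q) ≡ ind p * ind q
ind-∧ false q = refl
ind-∧ true  q = sym (+-identityʳ (ind q))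

ind-∨ : ∀ p q → ind (p ∨ q) ≤ ind p + ind q
ind-∨ false q = ≤-refl
ind-∨ true  q = s≤s z≤n

ind-idem : ∀ p → ind p * ind p ≡ ind p
ind-idem false = refl
ind-idem true  = refl

ind≤1 : ∀ p → ind p ≤ 1
ind≤1 false = z≤n
ind≤1 true  = s≤s z≤n

split₃-double : ∀ a b c →
  2 * ind (split₃ a b c) ≡ ind (not (a == b)) + ind (not (a == c)) + ind (not (b == c))
split₃-double false false false = refl
split₃-double false false true  = refl
split₃-double false true  false = refl
split₃-double false true  true  = refl
split₃-double true  false false = refl
split₃-double true  false true  = refl
split₃-double true  true  false = refl
split₃-double true  true  true  = refl

split₃-complement : ∀ a b c →
  ind (split₃ a b c)
    + (ind (a == false) * ind (b == false) * ind (c == false)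
       + ind (a == true) * ind (b == true) * ind (c == true)) ≡ 1
split₃-complement false false false = refl
split₃-complement false false true  = refl
split₃-complement false true  false = refl
split₃-complement false true  true  = refl
split₃-complement true  false false = refl
split₃-complement true  false true  = refl
split₃-complement true  true  false = refl
split₃-complement true  true  true  = refl

split₃-constant : ∀ {a b c} → a ≡ b → b ≡ c → split₃ a b c ≡ false
split₃-constant {false} refl refl = refl
split₃-constant {true}  refl refl = refl

sumFin-cong : ∀ {m} {f g : Fin m → ℕ} → (∀ i → f i ≡ g i) → sumFin f ≡ sumFin g
sumFin-cong {zero}  eq = refl
sumFin-cong {suc m} eq = cong₂ _+_ (eq Fin.zero) (sumFin-cong (eq ∘ Fin.suc))

sumFin-zero : ∀ {m} → sumFin {m} (λ _ → 0) ≡ 0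
sumFin-zero {zero}  = refl
sumFin-zero {suc m} = sumFin-zero {m}

sumFin-+ : ∀ {m} (f g : Fin m → ℕ) → sumFin (λ i → f i + g i) ≡ sumFin f + sumFin g
sumFin-+ {zero}  f g = refl
sumFin-+ {suc m} f g =
  trans (cong (f Fin.zero + g Fin.zero +_) (sumFin-+ (f ∘ Fin.suc) (g ∘ Fin.suc)))
        (interchange (f Fin.zero) (g Fin.zero) _ _)

sumFin-* : ∀ {m} c (f : Fin m → ℕ) → sumFin (λ i → c * f i) ≡ c * sumFin f
sumFin-* {zero}  c f = sym (*-zeroʳ c)
sumFin-* {suc m} c f =
  trans (cong (c * f Fin.zero +_) (sumFin-* c (f ∘ Fin.suc))) (sym (*-distribˡ-+ c _ _))

sumFin-mono : ∀ {m} {f g : Fin m → ℕ} → (∀ i → f i ≤ g i) → sumFin f ≤ sumFin g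
sumFin-mono {zero}  le = z≤n
sumFin-mono {suc m} le = +-mono-≤ (le Fin.zero) (sumFin-mono (le ∘ Fin.suc))

sumFin-swap : ∀ {m k} (h : Fin m → Fin k → ℕ) →
  sumFin (λ a → sumFin (h a)) ≡ sumFin (λ b → sumFin (λ a → h a b))
sumFin-swap {zero} {k} h = sym (sumFin-zero {k})
sumFin-swap {suc m} h =
  trans (cong (sumFin (h Fin.zero) +_) (sumFin-swap (h ∘ Fin.suc))) (sym (sumFin-+ (h Fin.zero) _))

sumFin-point : ∀ {m} (x : Fin m) → sumFin (λ i → ind (does (i Finₚ.≟ x))) ≡ 1
sumFin-point {suc m} Fin.zero    = cong suc (sumFin-zero {m})
sumFin-point {suc m} (Fin.suc x) = sumFin-point x

if-+ : ∀ c x y → (if c then x + y else 0) ≡ (if c then x else 0) + (if c then y else 0)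
if-+ false x y = refl
if-+ true  x y = refl

if-* : ∀ c k x → (if c then k * x else 0) ≡ k * (if c then x else 0)
if-* false k x = sym (*-zeroʳ k)
if-* true  k x = refl

if-sumFin : ∀ {m} c (f : Fin m → ℕ) →
  (if c then sumFin f else 0) ≡ sumFin (λ i → if c then f i else 0)
if-sumFin {m} false f = sym (sumFin-zero {m})
if-sumFin true  f = refl

if-∧-false : ∀ c x → (if c ∧ false then x else 0) ≡ 0
if-∧-false false x = refl
if-∧-false true  x = refl

sumPairs-cong : ∀ {m} {f g : Fin m → Fin m → ℕ} →
  (∀ i j → f i j ≡ g i j) → sumPairs f ≡ sumPairs g
sumPairs-cong eq = sumFin-cong λ i → sumFin-cong λ j → cong (λ x → if lt i j then x else 0) (eq i j)

sumPairs-+ : ∀ {m} (f g : Fin m → Fin m → ℕ) →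
  sumPairs (λ i j → f i j + g i j) ≡ sumPairs f + sumPairs g
sumPairs-+ {m} f g =
  trans (sumFin-cong {m} λ i →
           trans (sumFin-cong {m} λ j → if-+ (lt i j) _ _) (sumFin-+ {m} _ _))
        (sumFin-+ {m} _ _)

sumPairs-* : ∀ {m} c (f : Fin m → Fin m → ℕ) → sumPairs (λ i j → c * f i j) ≡ c * sumPairs f
sumPairs-* {m} c f =
  trans (sumFin-cong {m} λ i →
           trans (sumFin-cong {m} λ j → if-* (lt i j) c _) (sumFin-* {m} c _))
        (sumFin-* {m} c _)

sumTriples-cong : ∀ {n} {f g : Fin n → Fin n → Fin n → ℕ} →
  (∀ u v w → f u v w ≡ g u v w) → sumTriples f ≡ sumTriples g
sumTriples-cong eq = sumFin-cong λ u → sumFin-cong λ v → sumFin-cong λ w →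
  cong (λ x → if lt u v ∧ lt v w then x else 0) (eq u v w)

sumTriples-+ : ∀ {n} (f g : Fin n → Fin n → Fin n → ℕ) →
  sumTriples (λ u v w → f u v w + g u v w) ≡ sumTriples f + sumTriples g
sumTriples-+ {n} f g =
  trans (sumFin-cong {n} λ u →
           trans (sumFin-cong {n} λ v →
                    trans (sumFin-cong {n} λ w → if-+ (lt u v ∧ lt v w) _ _)
                          (sumFin-+ {n} _ _))
                 (sumFin-+ {n} _ _))
        (sumFin-+ {n} _ _)

sumTriples-* : ∀ {n} c (f : Fin n → Fin n → Fin n → ℕ) →
  sumTriples (λ u v w → c * f u v w) ≡ c * sumTriples f
sumTriples-* {n} c f =
  trans (sumFin-cong {n} λ u →
           trans (sumFin-cong {n} λ v →
                    trans (sumFin-cong {n} λ w → if-* (lt u v ∧ lt v w) c _)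
                          (sumFin-* {n} c _))
                 (sumFin-* {n} c _))
        (sumFin-* {n} c _)

sumTriples-sumFin : ∀ {n m} (g : Fin m → Fin n → Fin n → Fin n → ℕ) →
  sumTriples (λ u v w → sumFin (λ i → g i u v w)) ≡ sumFin (λ i → sumTriples (g i))
sumTriples-sumFin {n} {m} g =
  trans (sumFin-cong λ u →
    trans (sumFin-cong λ v →
      trans (sumFin-cong λ w → if-sumFin (lt u v ∧ lt v w) (λ i → g i u v w))
            (sumFin-swap (λ w i → G i u v w)))
          (sumFin-swap (λ v i → sumFin (G i u v))))
        (sumFin-swap (λ u i → sumFin λ v → sumFin (G i u v)))
  where
  G : Fin m → Fin n → Fin n → Fin n → ℕ
  G i u v w = if lt u v ∧ lt v w then g i u v w else 0

sumTriples-if : ∀ {n} c (f : Fin n → Fin n → Fin n → ℕ) →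
  sumTriples (λ u v w → if c then f u v w else 0) ≡ (if c then sumTriples f else 0)
sumTriples-if false f = sumTriples-* 0 f  -- 0 * _ computes to 0 on both sides
sumTriples-if true  f = refl

sumTriples-sumPairs : ∀ {n m} (g : Fin m → Fin m → Fin n → Fin n → Fin n → ℕ) →
  sumTriples (λ u v w → sumPairs (λ i j → g i j u v w)) ≡ sumPairs (λ i j → sumTriples (g i j))
sumTriples-sumPairs g =
  trans (sumTriples-sumFin (λ i u v w → sumFin λ j → if lt i j then g i j u v w else 0))
        (sumFin-cong λ i →
          trans (sumTriples-sumFin (λ j u v w → if lt i j then g i j u v w else 0))
                (sumFin-cong λ j → sumTriples-if (lt i j) (g i j)))

sumTriples-suc : ∀ {n} (f : Fin (suc n) → Fin (suc n) → Fin (suc n) → ℕ) →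
  sumTriples f ≡ sumPairs (λ v w → f Fin.zero (Fin.suc v) (Fin.suc w))
               + sumTriples (λ u v w → f (Fin.suc u) (Fin.suc v) (Fin.suc w))
sumTriples-suc {n} f = cong₂ _+_ first rest
  where
  first : sumFin {suc n} (λ v → sumFin {suc n} λ w →
            if lt Fin.zero v ∧ lt v w then f Fin.zero v w else 0)
        ≡ sumPairs (λ v w → f Fin.zero (Fin.suc v) (Fin.suc w))
  first = cong (_+ sumPairs (λ v w → f Fin.zero (Fin.suc v) (Fin.suc w))) (sumFin-zero {suc n})
  rest : sumFin (λ u → sumFin {suc n} λ v → sumFin {suc n} λ w →
           if lt (Fin.suc u) v ∧ lt v w then f (Fin.suc u) v w else 0)
       ≡ sumTriples (λ u v w → f (Fin.suc u) (Fin.suc v) (Fin.suc w))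
  rest = sumFin-cong λ u → cong₂ _+_ (sumFin-zero {suc n}) (sumFin-cong λ v →
    cong (_+ sumFin (λ w → if lt u v ∧ lt v w then f (Fin.suc u) (Fin.suc v) (Fin.suc w) else 0))
         (if-∧-false (lt u v) (f (Fin.suc u) (Fin.suc v) Fin.zero)))

sumFin-square : ∀ {m} (x : Fin m → ℕ) →
  sumFin x * sumFin x ≡ sumFin (λ i → x i * x i) + 2 * sumPairs (λ i j → x i * x j)
sumFin-square {zero}  x = refl
sumFin-square {suc m} x = begin
  (x₀ + S) * (x₀ + S)                 ≡⟨ square-+ x₀ S ⟩
  x₀ * x₀ + 2 * (x₀ * S) + S * S      ≡⟨ cong₂ (λ p q → x₀ * x₀ + 2 * p + q)
                                           (sym (sumFin-* x₀ (x ∘ Fin.suc))) (sumFin-square (x ∘ Fin.suc)) ⟩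
  x₀ * x₀ + 2 * R + (Q + 2 * P)       ≡⟨ regroup (x₀ * x₀) R Q P ⟩
  x₀ * x₀ + Q + 2 * (R + P)           ∎
  where
  open ≡-Reasoning
  x₀ = x Fin.zero
  S  = sumFin (x ∘ Fin.suc)
  R  = sumFin (λ j → x₀ * x (Fin.suc j))
  Q  = sumFin (λ i → x (Fin.suc i) * x (Fin.suc i))
  P  = sumPairs (λ i j → x (Fin.suc i) * x (Fin.suc j))
  square-+ : ∀ a s → (a + s) * (a + s) ≡ a * a + 2 * (a * s) + s * s
  square-+ = solve-∀
  regroup : ∀ a r q p → a + 2 * r + (q + 2 * p) ≡ a + q + 2 * (r + p)
  regroup = solve-∀

count : ∀ {n} → (Fin n → Bool) → ℕ
count p = sumFin (λ u → ind (p u))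

within : ∀ {n} → (Fin n → Bool) → Fin n → Fin n → Fin n → ℕ
within p u v w = ind (p u) * ind (p v) * ind (p w)

count-all : ∀ {n} → count {n} (λ _ → true) ≡ n
count-all {zero}  = refl
count-all {suc n} = cong suc (count-all {n})

count-split : ∀ {n} (p c : Fin n → Bool) →
  count p ≡ count (λ u → p u ∧ c u == false) + count (λ u → p u ∧ c u == true)
count-split {n} p c = trans (sumFin-cong λ u → split (p u) (c u)) (sumFin-+ {n} _ _)
  where
  split : ∀ b x → ind b ≡ ind (b ∧ x == false) + ind (b ∧ x == true)
  split false x     = refl
  split true  false = refl
  split true  true  = refl

count-splitˡ : ∀ {n} (p c : Fin n → Bool) →
  count p ≡ count (λ u → c u == false ∧ p u) + count (λ u → c u == true ∧ p u)
count-splitˡ {n} p c = trans (sumFin-cong λ u → split (p u) (c u)) (sumFin-+ {n} _ _)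
  where
  split : ∀ b x → ind b ≡ ind (x == false ∧ b) + ind (x == true ∧ b)
  split b false = sym (+-identityʳ (ind b))
  split b true  = refl

within-∧ : ∀ {n} (p q : Fin n → Bool) u v w →
  within p u v w * within q u v w ≡ within (λ x → p x ∧ q x) u v w
within-∧ p q u v w = begin
  within p u v w * within q u v w
    ≡⟨ regroup (ind (p u)) (ind (p v)) (ind (p w)) (ind (q u)) (ind (q v)) (ind (q w)) ⟩
  ind (p u) * ind (q u) * (ind (p v) * ind (q v)) * (ind (p w) * ind (q w))
    ≡⟨ sym (cong₂ _*_ (cong₂ _*_ (ind-∧ (p u) (q u)) (ind-∧ (p v) (q v))) (ind-∧ (p w) (q w))) ⟩
  within (λ x → p x ∧ q x) u v w ∎
  where
  open ≡-Reasoning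
  regroup : ∀ a b c a′ b′ c′ → a * b * c * (a′ * b′ * c′) ≡ a * a′ * (b * b′) * (c * c′)
  regroup = solve-∀

C-suc : ∀ m k → suc m C suc k ≡ m C k + m C suc k
C-suc m k = sym (nCk+nC[k+1]≡[n+1]C[k+1] m k)

C2-suc : ∀ m → suc m C 2 ≡ m + m C 2
C2-suc m = trans (C-suc m 1) (cong (_+ m C 2) (nC1≡n m))

C-step : ∀ b m k → ind b * (m C k) + m C suc k ≡ (ind b + m) C suc k
C-step false m k = refl
C-step true  m k = trans (cong (_+ m C suc k) (*-identityˡ (m C k))) (sym (C-suc m k))

sumPairs-within : ∀ {n} (p : Fin n → Bool) →
  sumPairs (λ v w → ind (p v) * ind (p w)) ≡ count p C 2
sumPairs-within {zero}  p = refl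
sumPairs-within {suc n} p = begin
  sumFin (λ j → ind p₀ * ind (p′ j)) + sumPairs (λ v w → ind (p′ v) * ind (p′ w))
    ≡⟨ cong₂ _+_ (sumFin-* (ind p₀) (λ j → ind (p′ j))) (sumPairs-within p′) ⟩
  ind p₀ * count p′ + count p′ C 2
    ≡⟨ cong (λ x → ind p₀ * x + count p′ C 2) (sym (nC1≡n (count p′))) ⟩
  ind p₀ * (count p′ C 1) + count p′ C 2
    ≡⟨ C-step p₀ (count p′) 1 ⟩
  count p C 2 ∎
  where
  open ≡-Reasoning
  p₀ = p Fin.zero
  p′ = p ∘ Fin.suc

sumTriples-within : ∀ {n} (p : Fin n → Bool) → sumTriples (within p) ≡ count p C 3
sumTriples-within {zero}  p = refl
sumTriples-within {suc n} p = begin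
  sumTriples (within p)
    ≡⟨ sumTriples-suc (within p) ⟩
  sumPairs (λ v w → ind p₀ * ind (p′ v) * ind (p′ w)) + sumTriples (within p′)
    ≡⟨ cong₂ _+_ first (sumTriples-within p′) ⟩
  ind p₀ * (count p′ C 2) + count p′ C 3
    ≡⟨ C-step p₀ (count p′) 2 ⟩
  count p C 3 ∎
  where
  open ≡-Reasoning
  p₀ = p Fin.zero
  p′ = p ∘ Fin.suc
  first : sumPairs (λ v w → ind p₀ * ind (p′ v) * ind (p′ w)) ≡ ind p₀ * (count p′ C 2)
  first = trans (sumPairs-cong λ v w → *-assoc (ind p₀) (ind (p′ v)) (ind (p′ w)))
         (trans (sumPairs-* (ind p₀) (λ v w → ind (p′ v) * ind (p′ w)))
                (cong (ind p₀ *_) (sumPairs-within p′)))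

sumTriples-one : ∀ {n} → sumTriples {n} (λ _ _ _ → 1) ≡ n C 3
sumTriples-one {n} = trans (sumTriples-within {n} (λ _ → true)) (cong (_C 3) (count-all {n}))

C2-+ : ∀ a b → (a + b) C 2 ≡ a C 2 + a * b + b C 2
C2-+ zero    b = refl
C2-+ (suc a) b = begin
  suc (a + b) C 2                  ≡⟨ C2-suc (a + b) ⟩
  a + b + (a + b) C 2              ≡⟨ cong (a + b +_) (C2-+ a b) ⟩
  a + b + (a C 2 + a * b + b C 2)  ≡⟨ poly a b (a C 2) (b C 2) ⟩
  a + a C 2 + (1 + a) * b + b C 2  ≡⟨ cong (λ x → x + (1 + a) * b + b C 2) (sym (C2-suc a)) ⟩
  suc a C 2 + suc a * b + b C 2    ∎
  where
  open ≡-Reasoning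
  poly : ∀ a b A B → a + b + (A + a * b + B) ≡ a + A + (1 + a) * b + B
  poly = solve-∀

C3-+ : ∀ a b → (a + b) C 3 ≡ a C 3 + (a C 2) * b + a * (b C 2) + b C 3
C3-+ zero    b = refl
C3-+ (suc a) b = begin
  suc (a + b) C 3
    ≡⟨ C-suc (a + b) 2 ⟩
  (a + b) C 2 + (a + b) C 3
    ≡⟨ cong₂ _+_ (C2-+ a b) (C3-+ a b) ⟩
  a C 2 + a * b + b C 2 + (a C 3 + (a C 2) * b + a * (b C 2) + b C 3)
    ≡⟨ poly a b (a C 2) (a C 3) (b C 2) (b C 3) ⟩
  a C 2 + a C 3 + (a + a C 2) * b + (1 + a) * (b C 2) + b C 3
    ≡⟨ cong₂ (λ x y → x + y * b + (1 + a) * (b C 2) + b C 3) (sym (C-suc a 2)) (sym (C2-suc a)) ⟩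
  suc a C 3 + (suc a C 2) * b + suc a * (b C 2) + b C 3 ∎
  where
  open ≡-Reasoning
  poly : ∀ a b A₂ A₃ B₂ B₃ →
    A₂ + a * b + B₂ + (A₃ + A₂ * b + a * B₂ + B₃) ≡ A₂ + A₃ + (a + A₂) * b + (1 + a) * B₂ + B₃
  poly = solve-∀

C2-double : ∀ m → 2 * (m C 2) ≡ m * (m ∸ 1)
C2-double zero          = refl
C2-double (suc zero)    = refl
C2-double (suc (suc m)) = begin
  2 * (suc (suc m) C 2)        ≡⟨ cong (2 *_) (C2-suc (suc m)) ⟩
  2 * (suc m + suc m C 2)      ≡⟨ *-distribˡ-+ 2 (suc m) (suc m C 2) ⟩
  2 * suc m + 2 * (suc m C 2)  ≡⟨ cong (2 * suc m +_) (C2-double (suc m)) ⟩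
  2 * suc m + suc m * m        ≡⟨ poly m ⟩
  suc (suc m) * suc m          ∎
  where
  open ≡-Reasoning
  poly : ∀ m → 2 * (1 + m) + (1 + m) * m ≡ (2 + m) * (1 + m)
  poly = solve-∀

-- Holds despite truncated subtraction: if x or y is 0 both sides vanish.
*-∸2 : ∀ x y z → x * y * (x + y + z ∸ 2) ≡ x * y * ((x ∸ 1) + (y ∸ 1) + z)
*-∸2 zero    y       z = refl
*-∸2 (suc x) zero    z = trans (cong (_* (suc x + 0 + z ∸ 2)) (*-zeroʳ (suc x)))
                               (sym (cong (_* (x + 0 + z)) (*-zeroʳ (suc x))))
*-∸2 (suc x) (suc y) z = cong (λ t → suc x * suc y * (t + z ∸ 1)) (+-suc x y)

classTerm : ℕ → ℕ → ℕ
classTerm a b = a * b * (b ∸ 1) + b * a * (a ∸ 1)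

pairTerm : ℕ → ℕ → ℕ → ℕ → ℕ
pairTerm a b c e = 3 * a * b * c + 3 * a * b * e + 3 * a * c * e + 3 * b * c * e
                 + a * e * (e ∸ 1) + b * c * (c ∸ 1) + c * b * (b ∸ 1) + e * a * (a ∸ 1)

class-count : ∀ T a b → T + (a C 3 + b C 3) ≡ (a + b) C 3 → T ≡ (a C 2) * b + a * (b C 2)
class-count T a b h = +-cancelʳ-≡ (a C 3 + b C 3) T _
  (trans h (trans (C3-+ a b) (shuffle (a C 3) ((a C 2) * b) (a * (b C 2)) (b C 3))))
  where
  shuffle : ∀ x y z w → x + y + z + w ≡ y + z + (x + w)
  shuffle = solve-∀

eight-class : ∀ a b → 8 * ((a C 2) * b + a * (b C 2)) ≡ (3 * (a + b) ∸ 6) * (a * b) + classTerm a b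
eight-class a b = begin
  8 * ((a C 2) * b + a * (b C 2))
    ≡⟨ double-out (a C 2) (b C 2) a b ⟩
  4 * (2 * (a C 2)) * b + 4 * a * (2 * (b C 2))
    ≡⟨ cong₂ (λ x y → 4 * x * b + 4 * a * y) (C2-double a) (C2-double b) ⟩
  4 * (a * (a ∸ 1)) * b + 4 * a * (b * (b ∸ 1))
    ≡⟨ poly a b (a ∸ 1) (b ∸ 1) ⟩
  3 * (a * b * ((a ∸ 1) + (b ∸ 1) + 0)) + classTerm a b
    ≡⟨ cong (λ x → 3 * x + classTerm a b) (sym (*-∸2 a b 0)) ⟩
  3 * (a * b * (a + b + 0 ∸ 2)) + classTerm a b
    ≡⟨ cong (λ x → 3 * (a * b * (x ∸ 2)) + classTerm a b) (+-identityʳ (a + b)) ⟩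
  3 * (a * b * (a + b ∸ 2)) + classTerm a b
    ≡⟨ cong (_+ classTerm a b) (trans (rotate 3 (a * b) (a + b ∸ 2))
                                      (cong (_* (a * b)) (*-distribˡ-∸ 3 (a + b) 2))) ⟩
  (3 * (a + b) ∸ 6) * (a * b) + classTerm a b ∎
  where
  open ≡-Reasoning
  double-out : ∀ A B a b → 8 * (A * b + a * B) ≡ 4 * (2 * A) * b + 4 * a * (2 * B)
  double-out = solve-∀
  poly : ∀ a b p q → 4 * (a * p) * b + 4 * a * (b * q) ≡ 3 * (a * b * (p + q + 0)) + (a * b * q + b * a * p)
  poly = solve-∀
  rotate : ∀ k x y → k * (x * y) ≡ k * y * x
  rotate = solve-∀

class-identity : ∀ {n} T a b → a + b ≡ n → T + (a C 3 + b C 3) ≡ n C 3 →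
  8 * T ≡ (3 * n ∸ 6) * (a * b) + classTerm a b
class-identity T a b refl h = trans (cong (8 *_) (class-count T a b h)) (eight-class a b)

-- Triples split by two classes with cells of sizes a, b, c, e (a, e and b, c
-- opposite): two vertices in one cell and one in the opposite cell, or three cells.
pairSplit : ℕ → ℕ → ℕ → ℕ → ℕ
pairSplit a b c e = (a C 2) * e + a * (e C 2) + ((b C 2) * c + b * (c C 2))
                  + (a * b * c + a * b * e + a * c * e + b * c * e)

pair-count : ∀ T a b c e →
  T + (((a + b) C 3 + (c + e) C 3) + ((a + c) C 3 + (b + e) C 3))
    ≡ (a + b + (c + e)) C 3 + ((a C 3 + b C 3) + (c C 3 + e C 3)) →
  T ≡ pairSplit a b c e
pair-count T a b c e h = +-cancelʳ-≡ _ T _ (trans h expansion)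
  where
  open ≡-Reasoning
  cells = (a C 3 + b C 3) + (c C 3 + e C 3)
  poly : ∀ a b c e A₂ B₂ C₂ E₂ A₃ B₃ C₃ E₃ X Y →
      X + (A₂ + a * b + B₂) * (c + e) + (a + b) * (C₂ + c * e + E₂) + Y + ((A₃ + B₃) + (C₃ + E₃))
    ≡ A₂ * e + a * E₂ + (B₂ * c + b * C₂) + (a * b * c + a * b * e + a * c * e + b * c * e)
      + ((X + Y) + ((A₃ + A₂ * c + a * C₂ + C₃) + (B₃ + B₂ * e + b * E₂ + E₃)))
  poly = solve-∀
  expansion : (a + b + (c + e)) C 3 + cells
            ≡ pairSplit a b c e + (((a + b) C 3 + (c + e) C 3) + ((a + c) C 3 + (b + e) C 3))
  expansion = begin
    (a + b + (c + e)) C 3 + cells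
      ≡⟨ cong (_+ cells) (C3-+ (a + b) (c + e)) ⟩
    (a + b) C 3 + ((a + b) C 2) * (c + e) + (a + b) * ((c + e) C 2) + (c + e) C 3 + cells
      ≡⟨ cong₂ (λ x y → (a + b) C 3 + x * (c + e) + (a + b) * y + (c + e) C 3 + cells)
               (C2-+ a b) (C2-+ c e) ⟩
    (a + b) C 3 + (a C 2 + a * b + b C 2) * (c + e) + (a + b) * (c C 2 + c * e + e C 2) + (c + e) C 3 + cells
      ≡⟨ poly a b c e (a C 2) (b C 2) (c C 2) (e C 2) (a C 3) (b C 3) (c C 3) (e C 3)
              ((a + b) C 3) ((c + e) C 3) ⟩
    pairSplit a b c e + (((a + b) C 3 + (c + e) C 3)
      + ((a C 3 + (a C 2) * c + a * (c C 2) + c C 3) + (b C 3 + (b C 2) * e + b * (e C 2) + e C 3)))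
      ≡⟨ cong₂ (λ x y → pairSplit a b c e + (((a + b) C 3 + (c + e) C 3) + (x + y)))
               (sym (C3-+ a c)) (sym (C3-+ b e)) ⟩
    pairSplit a b c e + (((a + b) C 3 + (c + e) C 3) + ((a + c) C 3 + (b + e) C 3)) ∎

eight-pair : ∀ a b c e →
  8 * pairSplit a b c e ≡ 2 * (a + b + (c + e) ∸ 2) * (a * e + b * c) + 2 * pairTerm a b c e
eight-pair a b c e = begin
  8 * pairSplit a b c e
    ≡⟨ double-out (a C 2) (b C 2) (c C 2) (e C 2) a b c e ⟩
  4 * (2 * (a C 2)) * e + 4 * a * (2 * (e C 2)) + (4 * (2 * (b C 2)) * c + 4 * b * (2 * (c C 2))) + 8 * t
    ≡⟨ cong₂ (λ x y → x + y + 8 * t)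
         (cong₂ (λ x y → 4 * x * e + 4 * a * y) (C2-double a) (C2-double e))
         (cong₂ (λ x y → 4 * x * c + 4 * b * y) (C2-double b) (C2-double c)) ⟩
  4 * (a * (a ∸ 1)) * e + 4 * a * (e * (e ∸ 1)) + (4 * (b * (b ∸ 1)) * c + 4 * b * (c * (c ∸ 1))) + 8 * t
    ≡⟨ poly a b c e (a ∸ 1) (b ∸ 1) (c ∸ 1) (e ∸ 1) ⟩
  2 * (a * e * ((a ∸ 1) + (e ∸ 1) + (b + c))) + 2 * (b * c * ((b ∸ 1) + (c ∸ 1) + (a + e)))
    + 2 * pairTerm a b c e
    ≡⟨ cong₂ (λ x y → 2 * x + 2 * y + 2 * pairTerm a b c e)
         (sym (*-∸2 a e (b + c))) (sym (*-∸2 b c (a + e))) ⟩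
  2 * (a * e * (a + e + (b + c) ∸ 2)) + 2 * (b * c * (b + c + (a + e) ∸ 2)) + 2 * pairTerm a b c e
    ≡⟨ cong₂ (λ x y → 2 * (a * e * (x ∸ 2)) + 2 * (b * c * (y ∸ 2)) + 2 * pairTerm a b c e)
         (reorder₁ a b c e) (reorder₂ a b c e) ⟩
  2 * (a * e * N) + 2 * (b * c * N) + 2 * pairTerm a b c e
    ≡⟨ cong (_+ 2 * pairTerm a b c e) (factor (a * e) (b * c) N) ⟩
  2 * N * (a * e + b * c) + 2 * pairTerm a b c e ∎
  where
  open ≡-Reasoning
  t = a * b * c + a * b * e + a * c * e + b * c * e
  N = a + b + (c + e) ∸ 2
  double-out : ∀ A B C E a b c e →
      8 * (A * e + a * E + (B * c + b * C) + (a * b * c + a * b * e + a * c * e + b * c * e))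
    ≡ 4 * (2 * A) * e + 4 * a * (2 * E) + (4 * (2 * B) * c + 4 * b * (2 * C))
      + 8 * (a * b * c + a * b * e + a * c * e + b * c * e)
  double-out = solve-∀
  poly : ∀ a b c e p q r s →
      4 * (a * p) * e + 4 * a * (e * s) + (4 * (b * q) * c + 4 * b * (c * r))
        + 8 * (a * b * c + a * b * e + a * c * e + b * c * e)
    ≡ 2 * (a * e * (p + s + (b + c))) + 2 * (b * c * (q + r + (a + e)))
      + 2 * (3 * a * b * c + 3 * a * b * e + 3 * a * c * e + 3 * b * c * e
             + a * e * s + b * c * r + c * b * q + e * a * p)
  poly = solve-∀
  reorder₁ : ∀ a b c e → a + e + (b + c) ≡ a + b + (c + e)
  reorder₁ = solve-∀
  reorder₂ : ∀ a b c e → b + c + (a + e) ≡ a + b + (c + e)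
  reorder₂ = solve-∀
  factor : ∀ x y N → 2 * (x * N) + 2 * (y * N) ≡ 2 * N * (x + y)
  factor = solve-∀

pair-identity : ∀ {n p q r s} T a b c e →
  p ≡ a + b → q ≡ c + e → r ≡ a + c → s ≡ b + e → n ≡ a + b + (c + e) →
  T + ((p C 3 + q C 3) + (r C 3 + s C 3)) ≡ n C 3 + ((a C 3 + b C 3) + (c C 3 + e C 3)) →
  8 * T ≡ 2 * (n ∸ 2) * (a * e + b * c) + 2 * pairTerm a b c e
pair-identity T a b c e refl refl refl refl refl h =
  trans (cong (8 *_) (pair-count T a b c e h)) (eight-pair a b c e)

module Separation {n D : ℕ} (side : Fin D → Fin n → Bool) where

  separates : Fin D → Fin n → Fin n → Fin n → ℕ
  separates i u v w = ind (split₃ (side i u) (side i v) (side i w))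

  separating : Fin n → Fin n → Fin n → ℕ
  separating u v w = sumFin (λ i → separates i u v w)

  separated : Fin D → ℕ
  separated i = sumTriples (separates i)

  separated₂ : Fin D → Fin D → ℕ
  separated₂ i j = sumTriples (λ u v w → separates i u v w * separates j u v w)

  monochromatic : Fin D → Fin n → Fin n → Fin n → ℕ
  monochromatic i u v w = within (λ x → side i x == false) u v w + within (λ x → side i x == true) u v w

  cell : Fin D → Fin D → Bool → Bool → Fin n → Bool
  cell i j a b x = side i x == a ∧ side j x == b

  n₀ n₁ : Fin D → ℕ
  n₀ i = cnt1 side i false
  n₁ i = cnt1 side i true

  n₀₀ n₀₁ n₁₀ n₁₁ : Fin D → Fin D → ℕ
  n₀₀ i j = cnt2 side i j false false
  n₀₁ i j = cnt2 side i j false true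
  n₁₀ i j = cnt2 side i j true false
  n₁₁ i j = cnt2 side i j true true

  n₀+n₁ : ∀ i → n₀ i + n₁ i ≡ n
  n₀+n₁ i = trans (sym (count-split (λ _ → true) (side i))) count-all

  n-cellsˡ : ∀ i j a → cnt1 side i a ≡ cnt2 side i j a false + cnt2 side i j a true
  n-cellsˡ i j a = count-split (λ u → side i u == a) (side j)

  n-cellsʳ : ∀ i j b → cnt1 side j b ≡ cnt2 side i j false b + cnt2 side i j true b
  n-cellsʳ i j b = count-splitˡ (λ u → side j u == b) (side i)

  sum-separating :
    sumTriples (λ u v w → separating u v w + separating u v w * separating u v w)
      ≡ 2 * sumFin separated + 2 * sumPairs separated₂
  sum-separating = begin
    sumTriples (λ u v w → F u v w + F u v w * F u v w)
      ≡⟨ sumTriples-cong square ⟩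
    sumTriples (λ u v w → 2 * F u v w + 2 * SP u v w)
      ≡⟨ sumTriples-+ (λ u v w → 2 * F u v w) (λ u v w → 2 * SP u v w) ⟩
    sumTriples (λ u v w → 2 * F u v w) + sumTriples (λ u v w → 2 * SP u v w)
      ≡⟨ cong₂ _+_ (trans (sumTriples-* 2 F) (cong (2 *_) (sumTriples-sumFin (λ i → separates i))))
                   (trans (sumTriples-* 2 SP) (cong (2 *_) (sumTriples-sumPairs
                     (λ i j u v w → separates i u v w * separates j u v w)))) ⟩
    2 * sumFin separated + 2 * sumPairs separated₂ ∎
    where
    open ≡-Reasoning
    F = separating
    SP : Fin n → Fin n → Fin n → ℕ
    SP u v w = sumPairs (λ i j → separates i u v w * separates j u v w)
    two : ∀ a b → a + (a + 2 * b) ≡ 2 * a + 2 * b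
    two = solve-∀
    square : ∀ u v w → F u v w + F u v w * F u v w ≡ 2 * F u v w + 2 * SP u v w
    square u v w = begin
      F u v w + F u v w * F u v w
        ≡⟨ cong (F u v w +_) (sumFin-square (λ i → separates i u v w)) ⟩
      F u v w + (sumFin (λ i → separates i u v w * separates i u v w) + 2 * SP u v w)
        ≡⟨ cong (λ x → F u v w + (x + 2 * SP u v w))
                (sumFin-cong {D} λ i → ind-idem (split₃ (side i u) (side i v) (side i w))) ⟩
      F u v w + (F u v w + 2 * SP u v w)
        ≡⟨ two (F u v w) (SP u v w) ⟩
      2 * F u v w + 2 * SP u v w ∎

  separates+monochromatic : ∀ i u v w → separates i u v w + monochromatic i u v w ≡ 1
  separates+monochromatic i u v w = split₃-complement (side i u) (side i v) (side i w)

  sumTriples-monochromatic : ∀ i → sumTriples (monochromatic i) ≡ n₀ i C 3 + n₁ i C 3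
  sumTriples-monochromatic i =
    trans (sumTriples-+ {n} _ _) (cong₂ _+_ (sumTriples-within {n} _) (sumTriples-within {n} _))

  monochromatic-product : ∀ i j u v w →
    monochromatic i u v w * monochromatic j u v w
      ≡ (within (cell i j false false) u v w + within (cell i j false true) u v w)
      + (within (cell i j true false) u v w + within (cell i j true true) u v w)
  monochromatic-product i j u v w =
    trans (distrib (W i false) (W i true) (W j false) (W j true))
          (cong₂ _+_ (cong₂ _+_ (product false false) (product false true))
                     (cong₂ _+_ (product true false) (product true true)))
    where
    W : Fin D → Bool → ℕ
    W k a = within (λ x → side k x == a) u v w
    product : ∀ a b → W i a * W j b ≡ within (cell i j a b) u v w
    product a b = within-∧ (λ x → side i x == a) (λ x → side j x == b) u v w
    distrib : ∀ x y z t → (x + y) * (z + t) ≡ (x * z + x * t) + (y * z + y * t)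
    distrib = solve-∀

  separated-complement : ∀ i → separated i + (n₀ i C 3 + n₁ i C 3) ≡ n C 3
  separated-complement i = begin
    separated i + (n₀ i C 3 + n₁ i C 3)          ≡⟨ cong (separated i +_) (sym (sumTriples-monochromatic i)) ⟩
    separated i + sumTriples (monochromatic i)   ≡⟨ sym (sumTriples-+ {n} _ _) ⟩
    sumTriples (λ u v w → separates i u v w + monochromatic i u v w)
                                                 ≡⟨ sumTriples-cong {n} (separates+monochromatic i) ⟩
    sumTriples {n} (λ _ _ _ → 1)                     ≡⟨ sumTriples-one {n} ⟩
    n C 3                                        ∎
    where open ≡-Reasoning

  separated₂-complement : ∀ i j →
    separated₂ i j + ((n₀ i C 3 + n₁ i C 3) + (n₀ j C 3 + n₁ j C 3))
      ≡ n C 3 + ((n₀₀ i j C 3 + n₀₁ i j C 3) + (n₁₀ i j C 3 + n₁₁ i j C 3))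
  separated₂-complement i j = begin
    separated₂ i j + ((n₀ i C 3 + n₁ i C 3) + (n₀ j C 3 + n₁ j C 3))
      ≡⟨ cong (separated₂ i j +_) (sym (trans (sumTriples-+ (monochromatic i) (monochromatic j))
                                    (cong₂ _+_ (sumTriples-monochromatic i) (sumTriples-monochromatic j)))) ⟩
    separated₂ i j + sumTriples (λ u v w → monochromatic i u v w + monochromatic j u v w)
      ≡⟨ sym (sumTriples-+ (λ u v w → separates i u v w * separates j u v w) _) ⟩
    sumTriples (λ u v w → separates i u v w * separates j u v w
                          + (monochromatic i u v w + monochromatic j u v w))
      ≡⟨ sumTriples-cong {n} (λ u v w → complement-product (separates i u v w) (monochromatic i u v w)
                                        (separates j u v w) (monochromatic j u v w)
                                        (separates+monochromatic i u v w)
                                                        (separates+monochromatic j u v w)) ⟩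
    sumTriples (λ u v w → 1 + monochromatic i u v w * monochromatic j u v w)
      ≡⟨ sumTriples-+ {n} _ _ ⟩
    sumTriples {n} (λ _ _ _ → 1) + sumTriples (λ u v w → monochromatic i u v w * monochromatic j u v w)
      ≡⟨ cong₂ _+_ (sumTriples-one {n}) (trans (sumTriples-cong {n} (monochromatic-product i j))
           (trans (sumTriples-+ {n} _ _) (cong₂ _+_
             (trans (sumTriples-+ {n} _ _) (cong₂ _+_ (sumTriples-within {n} _) (sumTriples-within {n} _)))
             (trans (sumTriples-+ {n} _ _) (cong₂ _+_ (sumTriples-within {n} _) (sumTriples-within {n} _)))))) ⟩
    n C 3 + ((n₀₀ i j C 3 + n₀₁ i j C 3) + (n₁₀ i j C 3 + n₁₁ i j C 3)) ∎
    where
    open ≡-Reasoning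
    complement-product : ∀ x a y b → x + a ≡ 1 → y + b ≡ 1 → x * y + (a + b) ≡ 1 + a * b
    complement-product zero          _ _ b refl _ = cong suc (sym (+-identityʳ b))
    complement-product (suc zero)    _ y _ refl h = trans (cong (_+ _) (+-identityʳ y)) h
    complement-product (suc (suc _)) _ _ _ ()

  eight-sum-separated :
    8 * sumFin separated
      ≡ (3 * n ∸ 6) * sumFin (λ i → n₀ i * n₁ i) + sumFin (λ i → classTerm (n₀ i) (n₁ i))
  eight-sum-separated =
    trans (sym (sumFin-* {D} 8 separated))
    (trans (sumFin-cong {D} λ i →
              class-identity (separated i) (n₀ i) (n₁ i) (n₀+n₁ i) (separated-complement i))
    (trans (sumFin-+ {D} _ _)
           (cong (_+ sumFin (λ i → classTerm (n₀ i) (n₁ i))) (sumFin-* {D} (3 * n ∸ 6) _))))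

  eight-sum-separated₂ :
    8 * sumPairs separated₂
      ≡ 2 * (n ∸ 2) * sumPairs (λ i j → n₀₀ i j * n₁₁ i j + n₀₁ i j * n₁₀ i j)
      + 2 * sumPairs (λ i j → pairTerm (n₀₀ i j) (n₀₁ i j) (n₁₀ i j) (n₁₁ i j))
  eight-sum-separated₂ =
    trans (sym (sumPairs-* {D} 8 separated₂))
    (trans (sumPairs-cong {D} eight)
    (trans (sumPairs-+ {D} _ _) (cong₂ _+_ (sumPairs-* {D} (2 * (n ∸ 2)) _) (sumPairs-* {D} 2 _))))
    where
    eight : ∀ i j → 8 * separated₂ i j
      ≡ 2 * (n ∸ 2) * (n₀₀ i j * n₁₁ i j + n₀₁ i j * n₁₀ i j)
        + 2 * pairTerm (n₀₀ i j) (n₀₁ i j) (n₁₀ i j) (n₁₁ i j)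
    eight i j = pair-identity (separated₂ i j) (n₀₀ i j) (n₀₁ i j) (n₁₀ i j) (n₁₁ i j)
      (n-cellsˡ i j false) (n-cellsˡ i j true) (n-cellsʳ i j false) (n-cellsʳ i j true)
      (trans (sym (n₀+n₁ i)) (cong₂ _+_ (n-cellsˡ i j false) (n-cellsˡ i j true)))
      (separated₂-complement i j)

module _ {m : ℕ} where
  open DecMembership (Finₚ._≟_ {m}) using (_∈?_)

  members≤length : (L : List (Fin m)) → sumFin (λ i → ind (does (i ∈? L))) ≤ length L
  members≤length []      = ≤-reflexive (sumFin-zero {m})
  members≤length (x ∷ L) = begin
    sumFin (λ i → ind (does (i Finₚ.≟ x) ∨ does (i ∈? L)))
      ≤⟨ sumFin-mono (λ i → ind-∨ (does (i Finₚ.≟ x)) (does (i ∈? L))) ⟩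
    sumFin (λ i → ind (does (i Finₚ.≟ x)) + ind (does (i ∈? L)))
      ≡⟨ sumFin-+ (λ i → ind (does (i Finₚ.≟ x))) (λ i → ind (does (i ∈? L))) ⟩
    sumFin (λ i → ind (does (i Finₚ.≟ x))) + sumFin (λ i → ind (does (i ∈? L)))
      ≡⟨ cong (_+ sumFin (λ i → ind (does (i ∈? L)))) (sumFin-point x) ⟩
    suc (sumFin (λ i → ind (does (i ∈? L))))
      ≤⟨ s≤s (members≤length L) ⟩
    suc (length L) ∎
    where open ≤-Reasoning

module _ {n : ℕ} {E : Fin n → Fin n → Set} where

  _++ʷ_ : ∀ {a b c k l} → Walk E a b k → Walk E b c l → Walk E a c (k + l)
  here     ++ʷ V = V
  step e W ++ʷ V = step e (W ++ʷ V)

  reverseʷ : (∀ {x y} → E x y → E y x) → ∀ {a b k} → Walk E a b k → Walk E b a k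
  reverseʷ E-sym here = here
  reverseʷ E-sym (step {k = k} e W) =
    subst (Walk E _ _) (+-comm k 1) (reverseʷ E-sym W ++ʷ step (E-sym e) here)

mapʷ : ∀ {n} {E E′ : Fin n → Fin n → Set} → (∀ {x y} → E x y → E′ x y) →
       ∀ {a b k} → Walk E a b k → Walk E′ a b k
mapʷ f here       = here
mapʷ f (step e W) = step (f e) (mapʷ f W)

EdgeIn-sym : ∀ {n} {Es : List (Fin n × Fin n)} {x y} → EdgeIn Es x y → EdgeIn Es y x
EdgeIn-sym = Sum.swap

EdgeIn-mono : ∀ {n} {Es Es′ : List (Fin n × Fin n)} → (∀ {e} → e ∈ Es → e ∈ Es′) →
              ∀ {x y} → EdgeIn Es x y → EdgeIn Es′ x y
EdgeIn-mono sub = Sum.map sub sub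

module PartialCubeGeometry
  {n : ℕ} (G : Graph n) (d : Fin n → Fin n → ℕ) (isDistance : IsDistance G d)
  {D : ℕ} (cls : Fin n → Fin n → Fin D) (Θ-classes : ThetaClasses G d D cls)
  (side : Fin D → Fin n → Bool) (sides : Sides G cls side) where

  open Separation side
  open DecMembership (Finₚ._≟_ {D}) using (_∈?_)
  open DecMembership (Finₚ._≟_ {n}) using () renaming (_∈?_ to _∈?ᵥ_)

  Adj-sym : ∀ {x y} → Adj G x y → Adj G y x
  Adj-sym {x} {y} = subst T (adj-sym G x y)

  Adj-irrefl : ∀ {x y} → Adj G x y → x ≢ y
  Adj-irrefl {x} xy refl = subst T (irrefl G x) xy

  cls-sym : ∀ {x y} → Adj G x y → cls x y ≡ cls y x
  cls-sym {x} {y} = proj₁ Θ-classes x y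

  Θ⇒same-class : ∀ {x y a b} → Adj G x y → Adj G a b → Θ d x y a b → cls x y ≡ cls a b
  Θ⇒same-class {x} {y} {a} {b} xy ab = proj₂ (proj₁ (proj₂ Θ-classes) x y a b xy ab)

  geodesic : ∀ u v → Walk (Adj G) u v (d u v)
  geodesic u v = proj₁ (isDistance u v)

  d-minimal : ∀ {u v k} → Walk (Adj G) u v k → d u v ≤ k
  d-minimal {u} {v} = proj₂ (isDistance u v) _

  d-sym : ∀ u v → d u v ≡ d v u
  d-sym u v = ≤-antisym (d-minimal (reverseʷ Adj-sym (geodesic v u)))
                        (d-minimal (reverseʷ Adj-sym (geodesic u v)))

  d-triangle : ∀ u v w → d u w ≤ d u v + d v w
  d-triangle u v w = d-minimal (geodesic u v ++ʷ geodesic v w)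

  d-refl : ∀ u → d u u ≡ 0
  d-refl u = n≤0⇒n≡0 (d-minimal (here {u = u}))

  d≡0⇒≡ : ∀ {u v} → d u v ≡ 0 → u ≡ v
  d≡0⇒≡ {u} {v} eq with subst (Walk (Adj G) u v) eq (geodesic u v)
  ... | here = refl

  d-adj : ∀ {x y} → Adj G x y → d x y ≡ 1
  d-adj xy = ≤-antisym (d-minimal (step xy here)) (n≢0⇒n>0 (Adj-irrefl xy ∘ d≡0⇒≡))

  farther-by-one : ∀ {x y s} → Adj G x y → d s x < d s y → d s y ≡ suc (d s x)
  farther-by-one {x} {y} {s} xy closer =
    ≤-antisym (≤-trans (d-triangle s x y) (≤-reflexive (trans (cong (d s x +_) (d-adj xy)) (+-comm (d s x) 1))))
              closer

  Θ-of-flip : ∀ {x y s s′} → Adj G x y → d s x < d s y → d s′ y ≤ d s′ x → Θ d x y s s′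
  Θ-of-flip {x} {y} {s} {s′} xy closer farther eq =
    <⇒≢ sum-lt (trans (cong₂ _+_ (d-sym s x) (d-sym s′ y))
                      (trans eq (cong₂ _+_ (d-sym x s′) (d-sym y s))))
    where
    sum-lt : d s x + d s′ y < d s′ x + d s y
    sum-lt = begin-strict
      d s x + d s′ y        ≤⟨ +-monoʳ-≤ (d s x) farther ⟩
      d s x + d s′ x        <⟨ n<1+n _ ⟩
      suc (d s x + d s′ x)  ≡⟨ cong suc (+-comm (d s x) (d s′ x)) ⟩
      suc (d s′ x + d s x)  ≡⟨ sym (+-suc (d s′ x) (d s x)) ⟩
      d s′ x + suc (d s x)  ≡⟨ cong (d s′ x +_) (sym (farther-by-one xy closer)) ⟩
      d s′ x + d s y        ∎
      where open ≤-Reasoning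

  -- The first step of the walk leaving the x-half would be an edge in relation Θ with xy.
  closer-along-avoiding : ∀ {x y s t k} → Adj G x y → Walk (AdjMinus G cls (cls x y)) s t k →
                          d s x < d s y → d t x < d t y
  closer-along-avoiding xy here closer = closer
  closer-along-avoiding {x} {y} xy (step {w = s′} (ss′ , avoid) W) closer with d s′ x <? d s′ y
  ... | yes closer′ = closer-along-avoiding xy W closer′
  ... | no  ¬closer = ⊥-elim (avoid (sym (Θ⇒same-class xy ss′ (Θ-of-flip xy closer (≮⇒≥ ¬closer)))))

  side-separates : ∀ {x y v} → Adj G x y → d v y < d v x → side (cls x y) x ≢ side (cls x y) v
  side-separates {x} {y} {v} xy v-closer same with proj₁ (sides (cls x y) x v) same
  ... | _ , W = <-asym v-closer (closer-along-avoiding xy W x-closer)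
    where
    x-closer : d x x < d x y
    x-closer = subst₂ _<_ (sym (d-refl x)) (sym (d-adj xy)) (s≤s z≤n)

  side-adj : ∀ {j u x} → Adj G u x → cls u x ≢ j → side j u ≡ side j x
  side-adj {j} {u} {x} ux avoid = proj₂ (sides j u x) (1 , step (ux , avoid) here)

  sideVector : Fin n → Fin D → Bool
  sideVector u i = side i u

  hamming-self : ∀ u → hamming (sideVector u) (sideVector u) ≡ 0
  hamming-self u = trans (sumFin-cong λ i → cong (ind ∘ not) (==-refl (side i u))) (sumFin-zero {D})
    where
    ==-refl : ∀ a → a == a ≡ true
    ==-refl false = refl
    ==-refl true  = refl

  hamming-step : ∀ {u x v} → Adj G u x → d v x < d v u →
    hamming (sideVector u) (sideVector v) ≡ suc (hamming (sideVector x) (sideVector v))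
  hamming-step {u} {x} {v} ux v-closer =
    trans (sumFin-cong step-at)
    (trans (sumFin-+ {D} _ _)
    (trans (cong (hamming (sideVector x) (sideVector v) +_) (sumFin-point (cls u x)))
           (+-comm _ 1)))
    where
    x-closer : d x x < d x u
    x-closer = subst₂ _<_ (sym (d-refl x)) (sym (trans (d-sym x u) (d-adj ux))) (s≤s z≤n)
    flip : ∀ a b c → a ≢ b → a ≢ c → ind (not (a == c)) ≡ ind (not (b == c)) + 1
    flip false false _     a≢b _   = ⊥-elim (a≢b refl)
    flip true  true  _     a≢b _   = ⊥-elim (a≢b refl)
    flip false true  false _   a≢c = ⊥-elim (a≢c refl)
    flip true  false true  _   a≢c = ⊥-elim (a≢c refl)
    flip false true  true  _   _   = refl
    flip true  false false _   _   = refl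
    step-at : ∀ j → ind (not (side j u == side j v))
                  ≡ ind (not (side j x == side j v)) + ind (does (j Finₚ.≟ cls u x))
    step-at j with j Finₚ.≟ cls u x
    ... | yes refl = flip _ _ _ (side-separates ux x-closer) (side-separates ux v-closer)
    ... | no  j≢ux = trans (cong (λ a → ind (not (a == side j v))) (side-adj ux (j≢ux ∘ sym)))
                           (sym (+-identityʳ _))

  d≡hamming : ∀ u v → d u v ≡ hamming (sideVector u) (sideVector v)
  d≡hamming u v = by-length (d u v) refl
    where
    by-length : ∀ k {u v} → d u v ≡ k → d u v ≡ hamming (sideVector u) (sideVector v)
    by-length zero {u} eq with d≡0⇒≡ eq
    ... | refl = trans eq (sym (hamming-self u))
    by-length (suc k) {u} {v} eq with subst (Walk (Adj G) u v) eq (geodesic u v)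
    ... | step {w = x} ux rest =
      trans eq (trans (cong suc (trans (sym d-xv) (by-length k d-xv))) (sym (hamming-step ux v-closer)))
      where
      d-xv : d x v ≡ k
      d-xv = ≤-antisym (d-minimal rest)
                       (≤-pred (subst (_≤ suc (d x v)) eq (d-minimal (step ux (geodesic x v)))))
      v-closer : d v x < d v u
      v-closer = subst₂ _<_ (sym (trans (d-sym v x) d-xv)) (sym (trans (d-sym v u) eq)) (n<1+n k)

  separating-double : ∀ u v w → 2 * separating u v w ≡ d u v + d u w + d v w
  separating-double u v w =
    trans (sym (sumFin-* 2 (λ i → separates i u v w)))
    (trans (sumFin-cong λ i → split₃-double (side i u) (side i v) (side i w))
    (trans (sumFin-+ {D} _ _)
    (trans (cong (_+ _) (sumFin-+ {D} _ _))
           (sym (cong₂ _+_ (cong₂ _+_ (d≡hamming u v) (d≡hamming u w)) (d≡hamming v w))))))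

  median-sum : ∀ {u v w m} → OnGeodesic d u v m → OnGeodesic d u w m → OnGeodesic d v w m →
               2 * (d u m + (d v m + d w m)) ≡ d u v + d u w + d v w
  median-sum {u} {v} {w} {m} uv uw vw = begin
    2 * (d u m + (d v m + d w m))
      ≡⟨ pairs (d u m) (d v m) (d w m) ⟩
    (d u m + d v m) + (d u m + d w m) + (d v m + d w m)
      ≡⟨ cong₂ _+_ (cong₂ _+_ (via uv (d-sym v m)) (via uw (d-sym w m))) (via vw (d-sym w m)) ⟩
    d u v + d u w + d v w ∎
    where
    open ≡-Reasoning
    pairs : ∀ a b c → 2 * (a + (b + c)) ≡ (a + b) + (a + c) + (b + c)
    pairs = solve-∀
    via : ∀ {a b c x} → a + b ≡ c → x ≡ b → a + x ≡ c
    via eq refl = eq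

  edgeClass : Fin n × Fin n → Fin D
  edgeClass e = cls (proj₁ e) (proj₂ e)

  separating≤edges : ∀ {Vs Es u v w} → ConnectedSubgraph G Vs Es →
    T (Vs u) → T (Vs v) → T (Vs w) → separating u v w ≤ length Es
  separating≤edges {Vs} {Es} {u} {v} {w} (proper , _ , connected) u∈ v∈ w∈ = begin
    separating u v w                          ≤⟨ sumFin-mono bound ⟩
    sumFin (λ i → ind (does (i ∈? classes)))  ≤⟨ members≤length classes ⟩
    length classes                            ≡⟨ length-map edgeClass Es ⟩
    length Es                                 ∎
    where
    open ≤-Reasoning
    classes = map edgeClass Es
    avoiding : ∀ {i} → ¬ i ∈ classes → ∀ {x y} → EdgeIn Es x y → AdjMinus G cls i x y
    avoiding i∉ (inj₁ xy∈) = proj₁ (proj₂ (All.lookup proper xy∈)) ,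
                             λ eq → i∉ (subst (_∈ classes) eq (∈-map⁺ edgeClass xy∈))
    avoiding i∉ (inj₂ yx∈) = Adj-sym yx ,
                             λ eq → i∉ (subst (_∈ classes) (trans (cls-sym yx) eq) (∈-map⁺ edgeClass yx∈))
      where yx = proj₁ (proj₂ (All.lookup proper yx∈))
    same-side : ∀ {i} → ¬ i ∈ classes → ∀ {x y} → T (Vs x) → T (Vs y) → side i x ≡ side i y
    same-side {i} i∉ {x} {y} x∈ y∈ with connected x y x∈ y∈
    ... | k , W = proj₂ (sides i x y) (k , mapʷ (avoiding i∉) W)
    bound : ∀ i → separates i u v w ≤ ind (does (i ∈? classes))
    bound i with i ∈? classes
    ... | yes _  = ind≤1 _
    ... | no  i∉ = ≤-reflexive (cong ind (split₃-constant (same-side i∉ u∈ v∈) (same-side i∉ v∈ w∈)))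

  ProperEdge : Fin n × Fin n → Set
  ProperEdge e = toℕ (proj₁ e) < toℕ (proj₂ e) × Adj G (proj₁ e) (proj₂ e)

  orient : Fin n → Fin n → Fin n × Fin n
  orient a b with toℕ a <? toℕ b
  ... | yes _ = a , b
  ... | no  _ = b , a

  orient-proper : ∀ {a b} → Adj G a b → ProperEdge (orient a b)
  orient-proper {a} {b} ab with toℕ a <? toℕ b
  ... | yes a<b = a<b , ab
  ... | no  a≮b = ≤∧≢⇒< (≮⇒≥ a≮b) (λ eq → Adj-irrefl ab (sym (Finₚ.toℕ-injective eq)))
                , Adj-sym ab

  orient-ends : ∀ (P : Fin n → Set) {a b} → P a → P b → P (proj₁ (orient a b)) × P (proj₂ (orient a b))
  orient-ends P {a} {b} pa pb with toℕ a <? toℕ b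
  ... | yes _ = pa , pb
  ... | no  _ = pb , pa

  orient-edgeIn : ∀ {a b Es} → orient a b ∈ Es → EdgeIn Es a b
  orient-edgeIn {a} {b} mem with toℕ a <? toℕ b
  ... | yes _ = inj₁ mem
  ... | no  _ = inj₂ mem

  record RootedSubgraph (m : Fin n) : Set where
    field
      vertices : List (Fin n)
      edges    : List (Fin n × Fin n)
      proper   : ∀ {e} → e ∈ edges → ProperEdge e × proj₁ e ∈ vertices × proj₂ e ∈ vertices
      reach    : ∀ {x} → x ∈ vertices → ∃ λ l → Walk (EdgeIn edges) x m l
  open RootedSubgraph

  verticesOf : ∀ {a b k} → Walk (Adj G) a b k → List (Fin n)
  verticesOf {a} here       = a ∷ []
  verticesOf {a} (step _ W) = a ∷ verticesOf W

  edgesOf : ∀ {a b k} → Walk (Adj G) a b k → List (Fin n × Fin n)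
  edgesOf here                        = []
  edgesOf (step {u = a} {w = x} _ W) = orient a x ∷ edgesOf W

  length-edgesOf : ∀ {a b k} (W : Walk (Adj G) a b k) → length (edgesOf W) ≡ k
  length-edgesOf here       = refl
  length-edgesOf (step _ W) = cong suc (length-edgesOf W)

  start∈verticesOf : ∀ {a b k} (W : Walk (Adj G) a b k) → a ∈ verticesOf W
  start∈verticesOf here       = here refl
  start∈verticesOf (step _ W) = here refl

  walkSubgraph : ∀ {a m k} → Walk (Adj G) a m k → RootedSubgraph m
  walkSubgraph W = record
    { vertices = verticesOf W ; edges = edgesOf W ; proper = proper-along W ; reach = reach-along W }
    where
    proper-along : ∀ {a b k} (W : Walk (Adj G) a b k) {e} → e ∈ edgesOf W →
                   ProperEdge e × proj₁ e ∈ verticesOf W × proj₂ e ∈ verticesOf W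
    proper-along (step ax W) (here refl) =
      orient-proper ax , orient-ends (_∈ verticesOf (step ax W)) (here refl) (there (start∈verticesOf W))
    proper-along (step ax W) (there e∈) = Product.map₂ (Product.map there there) (proper-along W e∈)
    reach-along : ∀ {a b k} (W : Walk (Adj G) a b k) {x} → x ∈ verticesOf W →
                  ∃ λ l → Walk (EdgeIn (edgesOf W)) x b l
    reach-along here (here refl) = 0 , here
    reach-along (step ax W) (here refl) with reach-along W (start∈verticesOf W)
    ... | l , V = suc l , step (orient-edgeIn (here refl)) (mapʷ (EdgeIn-mono there) V)
    reach-along (step ax W) (there x∈) = Product.map₂ (mapʷ (EdgeIn-mono there)) (reach-along W x∈)

  _∪_ : ∀ {m} → RootedSubgraph m → RootedSubgraph m → RootedSubgraph m
  R ∪ S = record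
    { vertices = vertices R ++ vertices S
    ; edges    = edges R ++ edges S
    ; proper   = [ Product.map₂ (Product.map ∈-++⁺ˡ ∈-++⁺ˡ) ∘ proper R
                 , Product.map₂ (Product.map (∈-++⁺ʳ (vertices R)) (∈-++⁺ʳ (vertices R))) ∘ proper S ]′
                 ∘ ∈-++⁻ (edges R)
    ; reach    = [ Product.map₂ (mapʷ (EdgeIn-mono ∈-++⁺ˡ)) ∘ reach R
                 , Product.map₂ (mapʷ (EdgeIn-mono (∈-++⁺ʳ (edges R)))) ∘ reach S ]′
                 ∘ ∈-++⁻ (vertices R)
    }

  _≟ₑ_ : (e e′ : Fin n × Fin n) → Dec (e ≡ e′)
  _≟ₑ_ = ≡-dec Finₚ._≟_ Finₚ._≟_

  spanned : ∀ {m} → RootedSubgraph m → Fin n → Bool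
  spanned R x = isYes (x ∈?ᵥ vertices R)

  rooted⇒connected : ∀ {m} (R : RootedSubgraph m) →
    ConnectedSubgraph G (spanned R) (deduplicate _≟ₑ_ (edges R))
  rooted⇒connected {m} R = All.tabulate proper′ , deduplicate-! _≟ₑ_ (edges R) , connected
    where
    proper′ : ∀ {e} → e ∈ deduplicate _≟ₑ_ (edges R) →
              toℕ (proj₁ e) < toℕ (proj₂ e) × Adj G (proj₁ e) (proj₂ e)
                × T (spanned R (proj₁ e)) × T (spanned R (proj₂ e))
    proper′ e∈ with proper R (∈-deduplicate⁻ _≟ₑ_ (edges R) e∈)
    ... | (lt , adj) , a∈ , b∈ = lt , adj , fromWitness a∈ , fromWitness b∈
    to-root : ∀ {x} → T (spanned R x) → ∃ λ l → Walk (EdgeIn (deduplicate _≟ₑ_ (edges R))) x m l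
    to-root x∈ = Product.map₂ (mapʷ (EdgeIn-mono (∈-deduplicate⁺ _≟ₑ_))) (reach R (toWitness x∈))
    connected : ∀ x y → T (spanned R x) → T (spanned R y) →
                ∃ λ k → Walk (EdgeIn (deduplicate _≟ₑ_ (edges R))) x y k
    connected x y x∈ y∈ with to-root x∈ | to-root y∈
    ... | k , W | l , V = k + l , W ++ʷ reverseʷ EdgeIn-sym V

  steiner≤walks : ∀ {u v w m s k₁ k₂ k₃} → IsSteiner3 G u v w s →
    Walk (Adj G) u m k₁ → Walk (Adj G) v m k₂ → Walk (Adj G) w m k₃ → s ≤ k₁ + (k₂ + k₃)
  steiner≤walks {s = s} {k₁} {k₂} {k₃} st W₁ W₂ W₃ = begin
    s                                   ≤⟨ proj₂ st _ _ (rooted⇒connected R)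
                                               (fromWitness u∈) (fromWitness v∈) (fromWitness w∈) ⟩
    length (deduplicate _≟ₑ_ (edges R)) ≤⟨ length-deduplicate _≟ₑ_ (edges R) ⟩
    length (edges R)                    ≡⟨ size ⟩
    k₁ + (k₂ + k₃)                      ∎
    where
    open ≤-Reasoning
    R = walkSubgraph W₁ ∪ (walkSubgraph W₂ ∪ walkSubgraph W₃)
    u∈ = ∈-++⁺ˡ (start∈verticesOf W₁)
    v∈ = ∈-++⁺ʳ (verticesOf W₁) (∈-++⁺ˡ (start∈verticesOf W₂))
    w∈ = ∈-++⁺ʳ (verticesOf W₁) (∈-++⁺ʳ (verticesOf W₂) (start∈verticesOf W₃))
    size = trans (length-++ (edgesOf W₁))
                 (cong₂ _+_ (length-edgesOf W₁)
                   (trans (length-++ (edgesOf W₂)) (cong₂ _+_ (length-edgesOf W₂) (length-edgesOf W₃))))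

  steiner-distance : Modular d → ∀ {u v w s} → IsSteiner3 G u v w s → s ≡ separating u v w
  steiner-distance modular {u} {v} {w} {s} st = ≤-antisym upper lower
    where
    lower : separating u v w ≤ s
    lower with proj₁ st
    ... | _ , _ , sub , u∈ , v∈ , w∈ , size =
      subst (separating u v w ≤_) size (separating≤edges sub u∈ v∈ w∈)
    upper : s ≤ separating u v w
    upper with modular u v w
    ... | m , uv , uw , vw =
      ≤-trans (steiner≤walks st (geodesic u m) (geodesic v m) (geodesic w m))
              (≤-reflexive (*-cancelˡ-≡ _ _ 2 (trans (median-sum uv uw vw) (sym (separating-double u v w)))))

theorem5p3 :
  ∀ {n : ℕ} (G : Graph n) → Connected G → 3 ≤ n →
  (d : Fin n → Fin n → ℕ) → IsDistance G d →
  Modular d → PartialCube G d →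
  (D : ℕ) (cls : Fin n → Fin n → Fin D) → ThetaClasses G d D cls →
  (side : Fin D → Fin n → Bool) → Sides G cls side →
  (sd : Fin n → Fin n → Fin n → ℕ) →
  (∀ u v w → IsSteiner3 G u v w (sd u v w)) →
  let n0  = λ i → cnt1 side i false
      n1  = λ i → cnt1 side i true
      n00 = λ i j → cnt2 side i j false false
      n01 = λ i j → cnt2 side i j false true
      n10 = λ i j → cnt2 side i j true false
      n11 = λ i j → cnt2 side i j true true
  in 4 * twoSWW3 sd ≡
       (3 * n ∸ 6) * sumFin (λ i → n0 i * n1 i)
     + 2 * (n ∸ 2) * sumPairs (λ i j → n00 i j * n11 i j + n01 i j * n10 i j)
     + sumFin (λ i → n0 i * n1 i * (n1 i ∸ 1) + n1 i * n0 i * (n0 i ∸ 1))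
     + 2 * sumPairs (λ i j →
           3 * n00 i j * n01 i j * n10 i j + 3 * n00 i j * n01 i j * n11 i j
         + 3 * n00 i j * n10 i j * n11 i j + 3 * n01 i j * n10 i j * n11 i j
         + n00 i j * n11 i j * (n11 i j ∸ 1) + n01 i j * n10 i j * (n10 i j ∸ 1)
         + n10 i j * n01 i j * (n01 i j ∸ 1) + n11 i j * n00 i j * (n00 i j ∸ 1))
theorem5p3 {n} G _ _ d isDistance modular _ D cls Θ-classes side sides sd steiner =
  trans (cong (4 *_) (trans steiner-sum sum-separating))
  (trans (four-twos (sumFin separated) (sumPairs separated₂))
  (trans (cong₂ _+_ eight-sum-separated eight-sum-separated₂)
         (shuffle ((3 * n ∸ 6) * sumFin (λ i → n₀ i * n₁ i)) (sumFin (λ i → classTerm (n₀ i) (n₁ i)))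
                  (2 * (n ∸ 2) * sumPairs (λ i j → n₀₀ i j * n₁₁ i j + n₀₁ i j * n₁₀ i j))
                  (2 * sumPairs (λ i j → pairTerm (n₀₀ i j) (n₀₁ i j) (n₁₀ i j) (n₁₁ i j))))))
  where
  open Separation side
  open PartialCubeGeometry G d isDistance cls Θ-classes side sides
  steiner-sum : twoSWW3 sd ≡ sumTriples (λ u v w → separating u v w + separating u v w * separating u v w)
  steiner-sum = sumTriples-cong λ u v w → cong (λ s → s + s * s) (steiner-distance modular (steiner u v w))
  four-twos : ∀ a b → 4 * (2 * a + 2 * b) ≡ 8 * a + 8 * b
  four-twos = solve-∀
  shuffle : ∀ a b c e → (a + b) + (c + e) ≡ a + c + b + e
  shuffle = solve-∀
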